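{- Let $r$ be a positive integer, and let $\ell$ and $k$ be nonnegative integers such that $k\geq b(r)+2$. Suppose $d\in B_r$ satisfies $d<p_{k+1}-r$ and $d(p_{k+\ell}-r)<(d+1)(p_k-r)$. If $\displaystyle n=d\,p_{k+\ell}\prod_{i=b(r)+1}^{k-1}p_i$, then $n\in F_r$.
   Context: $p_i$ denotes the $i$-th prime. For a positive integer $r$, the Schemmel totient function $S_r$ is the multiplicative function with $S_r(p^\alpha)=0$ if $p\le r$ and $S_r(p^\alpha)=p^{\alpha-1}(p-r)$ if $p>r$, for primes $p$ and positive integers $\alpha$. $B_r$ is the set of positive integers whose smallest prime factor exceeds $r$, together with $1$ (equivalently $B_r=\{n\in\mathbb{N}: S_r(n)>0\}$). $F_r$ is the set of $n\in B_r$ such that $S_r(n)<S_r(m)$ for all $m\in B_r$ with $m>n$ (sparsely Schemmel totient numbers of order $r$). $b(1)=0$, and for $r\ge 2$, $b(r)$ is the largest integer with $p_{b(r)}\le r$. -}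

module Defs where

open import Data.Nat using (ℕ; zero; suc; _+_; _*_; _∸_; _^_; _≤_; _<_; _≤?_; _⊔_; _!)
open import Data.Nat.Divisibility using (_∣_; _∣?_)
open import Data.Nat.Primality using (Prime; prime?)
open import Data.List using (List; []; _∷_; map; filter; upTo; foldr)
open import Data.Nat.ListAction using (product)
open import Data.Product using (_×_)
open import Relation.Nullary.Decidable using (_×-dec_)

range : ℕ → ℕ → List ℕ
range a c = map (λ j → a + j) (upTo (suc c ∸ a))

firstOr0 : List ℕ → ℕ
firstOr0 []      = 0
firstOr0 (x ∷ _) = x

-- The least prime exceeding p; searched in (p, p + p!], which always
-- contains a prime (a prime factor of p! + 1 exceeds p).
nextPrime : ℕ → ℕ
nextPrime p = firstOr0 (filter prime? (range (suc p) (p + p !)))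

-- nthPrime i = p_i (1-indexed: p_1 = 2, p_2 = 3, ...); nthPrime 0 is junk (= 1).
nthPrime : ℕ → ℕ
nthPrime zero          = 1
nthPrime (suc zero)    = 2
nthPrime (suc (suc i)) = nextPrime (nthPrime (suc i))

maxList : List ℕ → ℕ
maxList = foldr _⊔_ 0

-- b(r): the largest integer b with p_b ≤ r (b(1) = 0 and b(r) ≥ 1 for r ≥ 2).
-- Since p_i > i, any such b satisfies b < r, so searching 1..r suffices.
b : ℕ → ℕ
b r = maxList (filter (λ i → nthPrime i ≤? r) (range 1 r))

val : ℕ → ℕ → ℕ
val p n = maxList (filter (λ a → (p ^ a) ∣? n) (upTo (suc n)))

-- Schemmel totient S_r(n) for n ≥ 1: product over primes q ∣ n of
-- q^(v_q(n) - 1) * (q - r); the truncated subtraction q ∸ r is 0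
-- exactly when q ≤ r, matching S_r(q^α) = 0 for q ≤ r.
S : ℕ → ℕ → ℕ
S r n = product (map (λ q → q ^ (val q n ∸ 1) * (q ∸ r))
                     (filter (λ q → prime? q ×-dec (q ∣? n)) (upTo (suc n))))

B : ℕ → ℕ → Set
B r n = (1 ≤ n) × (∀ p → Prime p → p ∣ n → r < p)

F : ℕ → ℕ → Set
F r n = B r n × (∀ m → B r m → n < m → S r n < S r m)

primeProd : ℕ → ℕ → ℕ
primeProd a c = product (map nthPrime (range a c))

-- Write m ∈ B_r as m = X · ∏ L with L its prime factors, so that S_r(m) = X · ∏_{p ∈ L} (p − r),
-- while S_r(n) ≤ d · ∏_{b<i<k} (p_i − r) · (p_{k+ℓ} − r).  The i-th prime factor of m is at least
-- p_{b+i}, and the density (p − r)/p increases with p.  If m has fewer than k − b prime factors,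
-- its density S_r(m)/m exceeds that of n, so n < m gives S_r(n) < S_r(m).  If it has more,
-- S_r(m) ≥ ∏_{b<i≤k+1} (p_i − r), which the two hypotheses make larger than d (p_{k+ℓ} − r) ∏_{b<i<k} (p_i − r).
-- With exactly k − b prime factors, either X > d, or the largest prime factor c is at least
-- p_{k+ℓ} (densities again), or X ≤ d and c < p_{k+ℓ}; then n < m forces
-- p_{k+ℓ} ∏_{b<i<k} p_i < ∏ L, and a concavity estimate restores the density comparison.

module Submission where

open import Defs
open import Data.Nat using (ℕ; _+_; _*_; _∸_; _≤_; _<_)

open import Data.Nat
open import Data.Nat.Properties
open import Algebra.Properties.CommutativeSemigroup *-commutativeSemigroup
  using (interchange; x∙yz≈y∙xz; x∙yz≈y∙zx; x∙yz≈xz∙y; xy∙z≈xz∙y; xy∙z≈x∙zy)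
open import Data.Nat.Divisibility
open import Data.Nat.Primality
open import Data.Nat.Primality.Factorisation using (factorise)
open import Data.Nat.Induction using (<-rec)
open import Data.Nat.ListAction using (product)
open import Data.Nat.ListAction.Properties using (product-++)
open import Data.Nat.Tactic.RingSolver using (solve-∀)
open import Data.List using (List; []; _∷_; _++_; map; length; filter; upTo; applyUpTo)
open import Data.List.Properties using (map-++; map-∘; map-upTo; map-cong-local; map-id; ++-assoc)
open import Data.List.Membership.Propositional using (_∈_)
open import Data.List.Membership.Propositional.Properties
  using (∈-filter⁺; ∈-filter⁻; ∈-upTo⁺; ∈-upTo⁻; ∈-map⁺; ∈-map⁻)
open import Data.List.Relation.Unary.Any using (here; there)
open import Data.List.Relation.Unary.All as All using (All; []; _∷_)
import Data.List.Relation.Unary.All.Properties as All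
open import Data.List.Relation.Unary.All.Properties using (all-filter)
open import Data.List.Relation.Unary.AllPairs as AllPairs using (AllPairs; []; _∷_)
import Data.List.Relation.Unary.AllPairs.Properties as AllPairs
open import Data.List.Relation.Binary.Pointwise as Pointwise using (Pointwise; []; _∷_)
open import Data.List.Relation.Binary.Sublist.Propositional using (_⊆_; []; _∷_; _∷ʳ_; minimum)
open import Data.Product using (∃; ∃₂; _×_; _,_; proj₁; proj₂)
open import Data.Sum using (_⊎_; [_,_]′; inj₁; inj₂)
open import Data.Empty using (⊥-elim)
open import Function using (_∘_; _$_; id)
open import Level using (0ℓ)
open import Relation.Binary.Definitions using (tri<; tri≈; tri>)
open import Relation.Binary.PropositionalEquality
open import Relation.Nullary using (yes; no; ¬_)
open import Relation.Nullary.Decidable using (_×-dec_)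
open import Relation.Unary using (Pred; Decidable)

product∸ : ℕ → List ℕ → ℕ
product∸ r xs = product (map (_∸ r) xs)

product∸≤product : ∀ r xs → product∸ r xs ≤ product xs
product∸≤product r []       = ≤-refl
product∸≤product r (x ∷ xs) = *-mono-≤ (m∸n≤m x r) (product∸≤product r xs)

product∸>0 : ∀ {r xs} → All (r <_) xs → 0 < product∸ r xs
product∸>0 []         = s≤s z≤n
product∸>0 (r<x ∷ rs) = *-mono-≤ (m<n⇒0<n∸m r<x) (product∸>0 rs)

product>0 : ∀ {r xs} → All (r <_) xs → 0 < product xs
product>0 {r} {xs} rs = <-≤-trans (product∸>0 rs) (product∸≤product r xs)

product∸-++ : ∀ r xs ys → product∸ r (xs ++ ys) ≡ product∸ r xs * product∸ r ys
product∸-++ r xs ys = trans (cong product (map-++ (_∸ r) xs ys)) (product-++ (map (_∸ r) xs) (map (_∸ r) ys))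

product-snoc : ∀ xs x → product (xs ++ x ∷ []) ≡ product xs * x
product-snoc xs x = trans (product-++ xs (x ∷ [])) (cong (product xs *_) (*-identityʳ x))

product∸-snoc : ∀ r xs x → product∸ r (xs ++ x ∷ []) ≡ product∸ r xs * (x ∸ r)
product∸-snoc r xs x = trans (product∸-++ r xs (x ∷ [])) (cong (product∸ r xs *_) (*-identityʳ (x ∸ r)))

product-monoᵖ : ∀ {xs ys} → Pointwise _≤_ xs ys → product xs ≤ product ys
product-monoᵖ []         = ≤-refl
product-monoᵖ (x≤y ∷ ps) = *-mono-≤ x≤y (product-monoᵖ ps)

product∸-monoᵖ : ∀ r {xs ys} → Pointwise _≤_ xs ys → product∸ r xs ≤ product∸ r ys
product∸-monoᵖ r []         = ≤-refl
product∸-monoᵖ r (x≤y ∷ ps) = *-mono-≤ (∸-monoˡ-≤ r x≤y) (product∸-monoᵖ r ps)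

-- xs ≼[ r ] ys compares the densities product∸ r xs / product xs ≤ product∸ r ys / product ys;
-- for a squarefree number with prime factors xs this density is S_r(n)/n.
record _≼[_]_ (xs : List ℕ) (r : ℕ) (ys : List ℕ) : Set where
  constructor density≤
  field cross-mul : product ys * product∸ r xs ≤ product∸ r ys * product xs

open _≼[_]_ public

∸-ratio-mono : ∀ r {x y} → x ≤ y → y * (x ∸ r) ≤ (y ∸ r) * x
∸-ratio-mono r {x} {y} x≤y = begin
  y * (x ∸ r)    ≡⟨ *-distribˡ-∸ y x r ⟩
  y * x ∸ y * r  ≤⟨ ∸-monoʳ-≤ (y * x) (*-monoˡ-≤ r x≤y) ⟩
  y * x ∸ x * r  ≡⟨ cong (_∸ x * r) (*-comm y x) ⟩
  x * y ∸ x * r  ≡⟨ sym (*-distribˡ-∸ x y r) ⟩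
  x * (y ∸ r)    ≡⟨ *-comm x (y ∸ r) ⟩
  (y ∸ r) * x    ∎
  where open ≤-Reasoning

≼-∷ : ∀ {r x y xs ys} → y * (x ∸ r) ≤ (y ∸ r) * x → xs ≼[ r ] ys → (x ∷ xs) ≼[ r ] (y ∷ ys)
≼-∷ {r} {x} {y} {xs} {ys} head (density≤ tail) = density≤ $ begin
  (y * product ys) * ((x ∸ r) * product∸ r xs)  ≡⟨ interchange y (product ys) (x ∸ r) (product∸ r xs) ⟩
  (y * (x ∸ r)) * (product ys * product∸ r xs)  ≤⟨ *-mono-≤ head tail ⟩
  ((y ∸ r) * x) * (product∸ r ys * product xs)  ≡⟨ interchange (y ∸ r) x (product∸ r ys) (product xs) ⟩
  ((y ∸ r) * product∸ r ys) * (x * product xs)  ∎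
  where open ≤-Reasoning

≼-∷ˡ : ∀ {r xs ys} x → xs ≼[ r ] ys → (x ∷ xs) ≼[ r ] ys
≼-∷ˡ {r} {xs} {ys} x (density≤ xs≼ys) = density≤ $ begin
  product ys * ((x ∸ r) * product∸ r xs)  ≡⟨ x∙yz≈y∙xz (product ys) (x ∸ r) (product∸ r xs) ⟩
  (x ∸ r) * (product ys * product∸ r xs)  ≤⟨ *-mono-≤ (m∸n≤m x r) xs≼ys ⟩
  x * (product∸ r ys * product xs)        ≡⟨ x∙yz≈y∙xz x (product∸ r ys) (product xs) ⟩
  product∸ r ys * (x * product xs)        ∎
  where open ≤-Reasoning

≼-++ʳ : ∀ {r xs ys} zs → xs ≼[ r ] ys → (xs ++ zs) ≼[ r ] ys
≼-++ʳ {r} {xs} {ys} zs (density≤ xs≼ys) = density≤ $ begin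
  product ys * product∸ r (xs ++ zs)               ≡⟨ cong (product ys *_) (product∸-++ r xs zs) ⟩
  product ys * (product∸ r xs * product∸ r zs)     ≡⟨ sym (*-assoc (product ys) _ _) ⟩
  (product ys * product∸ r xs) * product∸ r zs     ≤⟨ *-mono-≤ xs≼ys (product∸≤product r zs) ⟩
  (product∸ r ys * product xs) * product zs        ≡⟨ *-assoc (product∸ r ys) _ _ ⟩
  product∸ r ys * (product xs * product zs)        ≡⟨ cong (product∸ r ys *_) (sym (product-++ xs zs)) ⟩
  product∸ r ys * product (xs ++ zs)               ∎
  where open ≤-Reasoning

≼-monoᵖ : ∀ r {xs ys} → Pointwise _≤_ xs ys → xs ≼[ r ] ys
≼-monoᵖ r []         = density≤ ≤-refl
≼-monoᵖ r (x≤y ∷ ps) = ≼-∷ (∸-ratio-mono r x≤y) (≼-monoᵖ r ps)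

⊆⇒≽ : ∀ r {xs ys} → xs ⊆ ys → ys ≼[ r ] xs
⊆⇒≽ r []             = density≤ ≤-refl
⊆⇒≽ r (y ∷ʳ xs⊆ys)  = ≼-∷ˡ y (⊆⇒≽ r xs⊆ys)
⊆⇒≽ r (_∷_ {x = x} refl xs⊆ys) = ≼-∷ (≤-reflexive (*-comm x (x ∸ r))) (⊆⇒≽ r xs⊆ys)

≼-transfer : ∀ {r xs ys} d X → xs ≼[ r ] ys → All (r <_) xs →
             d * product xs < X * product ys → d * product∸ r xs < X * product∸ r ys
≼-transfer {r} {xs} {ys} d X (density≤ xs≼ys) rs n<m = *-cancelʳ-< (product xs) _ _ (begin-strict
  d * product∸ r xs * product xs    ≡⟨ xy∙z≈xz∙y d (product∸ r xs) (product xs) ⟩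
  d * product xs * product∸ r xs    <⟨ *-monoˡ-< (product∸ r xs) {{>-nonZero (product∸>0 rs)}} n<m ⟩
  X * product ys * product∸ r xs    ≡⟨ *-assoc X (product ys) (product∸ r xs) ⟩
  X * (product ys * product∸ r xs)  ≤⟨ *-monoʳ-≤ X xs≼ys ⟩
  X * (product∸ r ys * product xs)  ≡⟨ sym (*-assoc X (product∸ r ys) (product xs)) ⟩
  X * product∸ r ys * product xs    ∎)
  where open ≤-Reasoning

drop-∷-∈ : ∀ {y ys zs} → All (y <_) zs → All (_∈ y ∷ ys) zs → All (_∈ ys) zs
drop-∷-∈ []           []                = []
drop-∷-∈ (y<z ∷ _)    (here refl ∷ _)   = ⊥-elim (<-irrefl refl y<z)
drop-∷-∈ (_ ∷ y<zs)   (there z∈ ∷ zs∈) = z∈ ∷ drop-∷-∈ y<zs zs∈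

sorted-⊆ : ∀ {xs ys} → AllPairs _<_ xs → AllPairs _<_ ys → All (_∈ ys) xs → xs ⊆ ys
sorted-⊆ {[]}     _             _            _                  = minimum _
sorted-⊆ {x ∷ xs} (x<xs ∷ sxs) (_ ∷ sys)    (here refl ∷ xs∈)  =
  refl ∷ sorted-⊆ sxs sys (drop-∷-∈ x<xs xs∈)
sorted-⊆ {x ∷ xs} {y ∷ ys} (x<xs ∷ sxs) (y<ys ∷ sys) (there x∈ys ∷ xs∈) =
  y ∷ʳ sorted-⊆ (x<xs ∷ sxs) sys (x∈ys ∷ drop-∷-∈ (All.map (<-trans y<x) x<xs) xs∈)
  where
  y<x : y < x
  y<x = All.lookup y<ys x∈ys

private
  expand-lhs : ∀ r x′ e c′ Rx Py →
    e * r * (Rx * Py * (r + c′)) + (x′ * Rx) * ((r + x′ + e) * Py) * (r + c′)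
      ≡ (x′ + e) * (r + x′) * (Rx * Py * (r + c′))
  expand-lhs = solve-∀

  expand-rhs : ∀ r x′ e c′ Ry Px Rx →
    (x′ + e) * (r + x′) * (Ry * Px * c′ + Rx * Px * r)
      ≡ (e * Rx * r) * ((r + x′) * Px)
        + (((x′ + e) * Ry) * ((r + x′) * Px) * c′ + (x′ * Rx) * ((r + x′) * Px) * r)
  expand-rhs = solve-∀

  regroup : ∀ r e c′ Rx Py → (e * Rx * r) * ((r + c′) * Py) ≡ e * r * (Rx * Py * (r + c′))
  regroup = solve-∀

  -- The inductive step of density-gap for x = r + x′, y = x + e and c = r + c′,
  -- which makes it an inequality between polynomials.
  density-gap-∷ : ∀ r x′ e c′ Ry Px Rx Py → Px ≤ Py → x′ ≤ c′ →
    Rx * Py * (r + c′) ≤ Ry * Px * c′ + Rx * Px * r →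
    (x′ * Rx) * ((r + x′ + e) * Py) * (r + c′)
      ≤ ((x′ + e) * Ry) * ((r + x′) * Px) * c′ + (x′ * Rx) * ((r + x′) * Px) * r
  density-gap-∷ r x′ e c′ Ry Px Rx Py Px≤Py x′≤c′ ih = +-cancelˡ-≤ slack _ _ (begin
    slack + _                                           ≡⟨ expand-lhs r x′ e c′ Rx Py ⟩
    (x′ + e) * (r + x′) * (Rx * Py * (r + c′))          ≤⟨ *-monoʳ-≤ ((x′ + e) * (r + x′)) ih ⟩
    (x′ + e) * (r + x′) * (Ry * Px * c′ + Rx * Px * r)  ≡⟨ expand-rhs r x′ e c′ Ry Px Rx ⟩
    (e * Rx * r) * ((r + x′) * Px) + rhs                ≤⟨ +-monoˡ-≤ rhs (*-monoʳ-≤ (e * Rx * r) (*-mono-≤ (+-monoʳ-≤ r x′≤c′) Px≤Py)) ⟩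
    (e * Rx * r) * ((r + c′) * Py) + rhs                ≡⟨ cong (_+ rhs) (regroup r e c′ Rx Py) ⟩
    slack + rhs                                         ∎)
    where
    open ≤-Reasoning
    slack rhs : ℕ
    slack = e * r * (Rx * Py * (r + c′))
    rhs = ((x′ + e) * Ry) * ((r + x′) * Px) * c′ + (x′ * Rx) * ((r + x′) * Px) * r

-- In terms of densities ρ = product∸ r / product this reads
-- c (ρ xs − ρ ys) ≤ r (product∸ r xs − product∸ r ys) / product ys.
density-gap : ∀ r c {xs ys} → Pointwise _≤_ xs ys → All (r <_) xs → All (_≤ c) xs →
  product∸ r xs * product ys * c ≤ product∸ r ys * product xs * (c ∸ r) + product∸ r xs * product xs * r
density-gap r c [] [] [] rewrite *-identityˡ c | *-identityˡ (c ∸ r) | *-identityˡ r =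
  ≤-trans (m≤n+m∸n c r) (≤-reflexive (+-comm r (c ∸ r)))
density-gap r c {x ∷ xs} {y ∷ ys} (x≤y ∷ xs≤ys) (r<x ∷ r<xs) (x≤c ∷ xs≤c)
  with m≤n⇒∃[o]m+o≡n (<⇒≤ r<x) | m≤n⇒∃[o]m+o≡n x≤y | m≤n⇒∃[o]m+o≡n (≤-trans (<⇒≤ r<x) x≤c)
... | x′ , refl | e , refl | c′ , refl
  rewrite m+n∸m≡n r x′ | m+n∸m≡n r c′ | +-assoc r x′ e | m+n∸m≡n r (x′ + e) | sym (+-assoc r x′ e) =
  density-gap-∷ r x′ e c′ (product∸ r ys) (product xs) (product∸ r xs) (product ys)
    (product-monoᵖ xs≤ys) (+-cancelˡ-≤ r _ _ x≤c)
    (subst (λ z → product∸ r xs * product ys * (r + c′) ≤ product∸ r ys * product xs * z + product∸ r xs * product xs * r)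
      (m+n∸m≡n r c′) (density-gap r (r + c′) xs≤ys r<xs xs≤c))

private
  collect : ∀ E u c q′ r → (u * c) * (E * q′) + E * u * c * r ≡ (E * u * c) * (q′ + r)
  collect = solve-∀

  distribute : ∀ A E v w q′ r →
    (v * A * w + E * A * r) * (q′ + r) ≡ (v * w) * (A * (q′ + r)) + (E * r) * (A * (q′ + r))
  distribute = solve-∀

  reassociate : ∀ E u c r → (E * r) * (u * c) ≡ E * u * c * r
  reassociate = solve-∀

  snoc-inequality : ∀ A E u v c w q′ r → E * u * c ≤ v * A * w + E * A * r → A * (q′ + r) ≤ u * c →
    (u * c) * (E * q′) ≤ (v * w) * (A * (q′ + r))
  snoc-inequality A E u v c w q′ r gap Aq≤uc = +-cancelʳ-≤ (E * u * c * r) _ _ (begin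
    (u * c) * (E * q′) + E * u * c * r                    ≡⟨ collect E u c q′ r ⟩
    (E * u * c) * (q′ + r)                                 ≤⟨ *-monoˡ-≤ (q′ + r) gap ⟩
    (v * A * w + E * A * r) * (q′ + r)                     ≡⟨ distribute A E v w q′ r ⟩
    (v * w) * (A * (q′ + r)) + (E * r) * (A * (q′ + r))    ≤⟨ +-monoʳ-≤ _ (*-monoʳ-≤ (E * r) Aq≤uc) ⟩
    (v * w) * (A * (q′ + r)) + (E * r) * (u * c)           ≡⟨ cong ((v * w) * (A * (q′ + r)) +_) (reassociate E u c r) ⟩
    (v * w) * (A * (q′ + r)) + E * u * c * r               ∎)
    where open ≤-Reasoning

-- A smaller last factor c < q can be compensated by a larger product of the earlier ones.
≼-snoc : ∀ {r c q xs ys} → Pointwise _≤_ xs ys → All (r <_) xs → All (_≤ c) xs → r ≤ q →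
         product xs * q ≤ product ys * c → (xs ++ q ∷ []) ≼[ r ] (ys ++ c ∷ [])
≼-snoc {r} {c} {q} {xs} {ys} xs≤ys r<xs xs≤c r≤q n≤m = density≤ (subst₂ _≤_
    (sym (cong₂ _*_ (product-snoc ys c) (product∸-snoc r xs q)))
    (sym (cong₂ _*_ (product∸-snoc r ys c) (product-snoc xs q)))
    (subst (λ z → (product ys * c) * (product∸ r xs * (q ∸ r)) ≤ (product∸ r ys * (c ∸ r)) * (product xs * z))
      q∸r+r≡q
      (snoc-inequality (product xs) (product∸ r xs) (product ys) (product∸ r ys) c (c ∸ r) (q ∸ r) r
        (density-gap r c xs≤ys r<xs xs≤c)
        (subst (λ z → product xs * z ≤ product ys * c) (sym q∸r+r≡q) n≤m))))
  where
  q∸r+r≡q : q ∸ r + r ≡ q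
  q∸r+r≡q = m∸n+n≡m r≤q

maxList-upper : ∀ {x xs} → x ∈ xs → x ≤ maxList xs
maxList-upper {x} {.x ∷ xs} (here refl) = m≤m⊔n x (maxList xs)
maxList-upper {x} {y ∷ xs}  (there x∈) = ≤-trans (maxList-upper x∈) (m≤n⊔m y (maxList xs))

maxList-∈ : ∀ xs → maxList xs ≡ 0 ⊎ maxList xs ∈ xs
maxList-∈ []       = inj₁ refl
maxList-∈ (x ∷ xs) with ⊔-sel x (maxList xs) | maxList-∈ xs
... | inj₁ x⊔≡x | _        = inj₂ (here x⊔≡x)
... | inj₂ x⊔≡m | inj₁ m≡0 = inj₁ (trans x⊔≡m m≡0)
... | inj₂ x⊔≡m | inj₂ m∈  = inj₂ (subst (_∈ x ∷ xs) (sym x⊔≡m) (there m∈))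

prime⇒2≤ : ∀ {p} → Prime p → 2 ≤ p
prime⇒2≤ {p} pp = nonTrivial⇒n>1 p {{prime⇒nonTrivial pp}}

n<m^n : ∀ m n → 2 ≤ m → n < m ^ n
n<m^n m zero    2≤m = s≤s z≤n
n<m^n m (suc n) 2≤m = begin-strict
  suc n      ≤⟨ n<m^n m n 2≤m ⟩
  m ^ n      <⟨ m<m*n (m ^ n) m {{m^n≢0 m n {{>-nonZero (<-trans (s≤s z≤n) 2≤m)}}}} 2≤m ⟩
  m ^ n * m  ≡⟨ *-comm (m ^ n) m ⟩
  m * m ^ n  ∎
  where open ≤-Reasoning

^-monoʳ-∣ : ∀ p {i j} → i ≤ j → p ^ i ∣ p ^ j
^-monoʳ-∣ p {i} i≤j with k , refl ← m≤n⇒∃[o]m+o≡n i≤j =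
  subst (p ^ i ∣_) (sym (^-distribˡ-+-* p i k)) (m∣m*n (p ^ k))

^val∣ : ∀ p n → p ^ val p n ∣ n
^val∣ p n with maxList-∈ (filter (λ a → p ^ a ∣? n) (upTo (suc n)))
... | inj₁ v≡0 = subst (λ a → p ^ a ∣ n) (sym v≡0) (1∣ n)
... | inj₂ v∈  = proj₂ (∈-filter⁻ (λ a → p ^ a ∣? n) {xs = upTo (suc n)} v∈)

^suc-val∤ : ∀ p n → 2 ≤ p → 1 ≤ n → ¬ (p ^ suc (val p n) ∣ n)
^suc-val∤ p n 2≤p 1≤n p^sv∣n = <-irrefl refl
  (maxList-upper (∈-filter⁺ (λ a → p ^ a ∣? n) (∈-upTo⁺ sv<sn) p^sv∣n))
  where
  sv<sn : suc (val p n) < suc n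
  sv<sn = s≤s (<⇒≤ (<-≤-trans (n<m^n p (suc (val p n)) 2≤p) (∣⇒≤ {{>-nonZero 1≤n}} p^sv∣n)))

val-unique : ∀ p n a → 2 ≤ p → 1 ≤ n → p ^ a ∣ n → ¬ (p ^ suc a ∣ n) → val p n ≡ a
val-unique p n a 2≤p 1≤n p^a∣n p^sa∤n with <-cmp (val p n) a
... | tri< v<a _ _ = ⊥-elim (^suc-val∤ p n 2≤p 1≤n (∣-trans (^-monoʳ-∣ p v<a) p^a∣n))
... | tri≈ _ v≡a _ = v≡a
... | tri> _ _ a<v = ⊥-elim (p^sa∤n (∣-trans (^-monoʳ-∣ p a<v) (^val∣ p n)))

val≡0 : ∀ q n → 2 ≤ q → 1 ≤ n → ¬ (q ∣ n) → val q n ≡ 0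
val≡0 q n 2≤q 1≤n q∤n = val-unique q n 0 2≤q 1≤n (1∣ n) (q∤n ∘ subst (_∣ n) (*-identityʳ q))

1≤val : ∀ q n → 2 ≤ q → 1 ≤ n → q ∣ n → 1 ≤ val q n
1≤val q n 2≤q 1≤n q∣n = n≢0⇒n>0 λ v≡0 →
  ^suc-val∤ q n 2≤q 1≤n (subst (λ v → q ^ suc v ∣ n) (sym v≡0) (subst (_∣ n) (sym (*-identityʳ q)) q∣n))

val-*-self : ∀ {p m} → Prime p → 1 ≤ m → val p (p * m) ≡ suc (val p m)
val-*-self {p} {m} pp 1≤m = val-unique p (p * m) (suc (val p m)) (prime⇒2≤ pp)
  (*-mono-≤ (<-trans (s≤s z≤n) (prime⇒2≤ pp)) 1≤m)
  (*-monoʳ-∣ p (^val∣ p m))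
  (λ h → ^suc-val∤ p m (prime⇒2≤ pp) 1≤m (*-cancelˡ-∣ p {{prime⇒nonZero pp}} h))

prime-power-∣-* : ∀ j {p q m} → Prime p → Prime q → q ≢ p → q ^ j ∣ p * m → q ^ j ∣ m
prime-power-∣-* zero    {m = m} _ _ _ _ = 1∣ m
prime-power-∣-* (suc j) {p} {q} {m} pp pq q≢p q^sj∣pm
  with euclidsLemma p m pq (∣-trans (m∣m*n (q ^ j)) q^sj∣pm)
... | inj₁ q∣p with prime⇒irreducible pp q∣p
...   | inj₁ q≡1 = ⊥-elim (<-irrefl (sym q≡1) (prime⇒2≤ pq))
...   | inj₂ q≡p = ⊥-elim (q≢p q≡p)
prime-power-∣-* (suc j) {p} {q} pp pq q≢p q^sj∣pm | inj₂ (divides m′ refl) =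
  subst (q * q ^ j ∣_) (*-comm q m′) (*-monoʳ-∣ q q^j∣m′)
  where
  q^j∣m′ : q ^ j ∣ m′
  q^j∣m′ = prime-power-∣-* j pp pq q≢p (*-cancelˡ-∣ q {{prime⇒nonZero pq}}
    (subst (q * q ^ j ∣_) (trans (sym (*-assoc p m′ q)) (*-comm (p * m′) q)) q^sj∣pm))

val-*-other : ∀ {p q m} → Prime p → Prime q → q ≢ p → 1 ≤ m → val q (p * m) ≡ val q m
val-*-other {p} {q} {m} pp pq q≢p 1≤m = val-unique q (p * m) (val q m) (prime⇒2≤ pq)
  (*-mono-≤ (<-trans (s≤s z≤n) (prime⇒2≤ pp)) 1≤m)
  (∣n⇒∣m*n p (^val∣ q m))
  (λ h → ^suc-val∤ q m (prime⇒2≤ pq) 1≤m (prime-power-∣-* (suc (val q m)) pp pq q≢p h))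

δ : ℕ → ℕ → ℕ
δ p q with q ≟ p
... | yes _ = q
... | no  _ = 1

δ-other : ∀ {p q} → q ≢ p → δ p q ≡ 1
δ-other {p} {q} q≢p with q ≟ p
... | yes q≡p = ⊥-elim (q≢p q≡p)
... | no  _   = refl

δ-self : ∀ p → δ p p ≡ p
δ-self p with p ≟ p
... | yes _   = refl
... | no  p≢p = ⊥-elim (p≢p refl)

product-map-* : ∀ (f g : ℕ → ℕ) xs →
  product (map (λ x → f x * g x) xs) ≡ product (map f xs) * product (map g xs)
product-map-* f g []       = refl
product-map-* f g (x ∷ xs) =
  trans (cong (f x * g x *_) (product-map-* f g xs)) (interchange (f x) (g x) _ _)

product-map-≡1 : ∀ {f : ℕ → ℕ} {xs} → All (λ x → f x ≡ 1) xs → product (map f xs) ≡ 1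
product-map-≡1 []               = refl
product-map-≡1 (fx≡1 ∷ fxs≡1) = cong₂ _*_ fx≡1 (product-map-≡1 fxs≡1)

product-map-δ : ∀ p {xs} → AllPairs _<_ xs → p ∈ xs → product (map (δ p) xs) ≡ p
product-map-δ p {_ ∷ xs} (p<xs ∷ _) (here refl) = begin
  δ p p * product (map (δ p) xs)  ≡⟨ cong₂ _*_ (δ-self p) (product-map-≡1 (All.map (δ-other ∘ >⇒≢) p<xs)) ⟩
  p * 1                          ≡⟨ *-identityʳ p ⟩
  p                              ∎
  where open ≡-Reasoning
product-map-δ p {x ∷ xs} (x<xs ∷ sorted) (there p∈) = begin
  δ p x * product (map (δ p) xs)  ≡⟨ cong₂ _*_ (δ-other (<⇒≢ (All.lookup x<xs p∈))) (product-map-δ p sorted p∈) ⟩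
  1 * p                          ≡⟨ *-identityˡ p ⟩
  p                              ∎
  where open ≡-Reasoning

upTo-sorted : ∀ n → AllPairs _<_ (upTo n)
upTo-sorted n = AllPairs.applyUpTo⁺₁ id n (λ i<j _ → i<j)

primesBelow : ℕ → List ℕ
primesBelow N = filter prime? (upTo N)

prime-factor : ∀ m → 2 ≤ m → ∃ λ p → Prime p × p ∣ m
prime-factor m 2≤m with factorise m {{>-nonZero (<-trans (s≤s z≤n) 2≤m)}}
... | record { factors = [] ; isFactorisation = m≡1 } = ⊥-elim (<-irrefl (sym m≡1) 2≤m)
... | record { factors = p ∷ ps ; isFactorisation = m≡ ; factorsPrime = pp ∷ _ } =
  p , pp , divides (product ps) (trans m≡ (*-comm p (product ps)))

^val-* : ∀ {p q m} → Prime p → Prime q → 1 ≤ m → q ^ val q (p * m) ≡ q ^ val q m * δ p q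
^val-* {p} {q} {m} pp pq 1≤m with q ≟ p
... | yes refl = trans (cong (q ^_) (val-*-self pp 1≤m)) (*-comm q (q ^ val q m))
... | no  q≢p  = trans (cong (q ^_) (val-*-other pp pq q≢p 1≤m)) (sym (*-identityʳ _))

prime-power-product : ∀ N m → 1 ≤ m → m < N → product (map (λ q → q ^ val q m) (primesBelow N)) ≡ m
prime-power-product N = <-rec P step
  where
  P : ℕ → Set
  P m = 1 ≤ m → m < N → product (map (λ q → q ^ val q m) (primesBelow N)) ≡ m
  step : ∀ m → (∀ {m′} → m′ < m → P m′) → P m
  step 1 _ _ _ = product-map-≡1 (All.map (λ {q} pq → cong (q ^_) (val≡0 q 1 (prime⇒2≤ pq) ≤-refl
    (λ q∣1 → <-irrefl (sym (∣1⇒≡1 q∣1)) (prime⇒2≤ pq)))) (all-filter prime? (upTo N)))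
  step m@(suc (suc _)) rec _ m<N with prime-factor m (s≤s (s≤s z≤n))
  ... | p , pp , divides m′ m≡m′p = begin
    product (map (λ q → q ^ val q m) ps)                          ≡⟨ cong product (map-cong-local (All.map ^val≡ (all-filter prime? (upTo N)))) ⟩
    product (map (λ q → q ^ val q m′ * δ p q) ps)                 ≡⟨ product-map-* (λ q → q ^ val q m′) (δ p) ps ⟩
    product (map (λ q → q ^ val q m′) ps) * product (map (δ p) ps) ≡⟨ cong₂ _*_ (rec m′<m 1≤m′ (<-trans m′<m m<N)) (product-map-δ p ps-sorted p∈ps) ⟩
    m′ * p                                                         ≡⟨ sym m≡m′p ⟩
    m                                                              ∎
    where
    open ≡-Reasoning
    ps = primesBelow N
    ps-sorted : AllPairs _<_ ps
    ps-sorted = AllPairs.filter⁺ prime? (upTo-sorted N)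
    1≤m′ : 1 ≤ m′
    1≤m′ = n≢0⇒n>0 λ { refl → 0≢1+n (sym m≡m′p) }
    m′<m : m′ < m
    m′<m = subst (m′ <_) (sym m≡m′p) (m<m*n m′ p {{>-nonZero 1≤m′}} (prime⇒2≤ pp))
    p∈ps : p ∈ ps
    p∈ps = ∈-filter⁺ prime? (∈-upTo⁺ (≤-<-trans (∣⇒≤ (divides m′ m≡m′p)) m<N)) pp
    ^val≡ : ∀ {q} → Prime q → q ^ val q m ≡ q ^ val q m′ * δ p q
    ^val≡ {q} pq = trans (cong (λ k → q ^ val q k) (trans m≡m′p (*-comm m′ p))) (^val-* pp pq 1≤m′)

filter-×-dec : ∀ {A : Set} {P Q : Pred A 0ℓ} (P? : Decidable P) (Q? : Decidable Q) xs →
  filter (λ x → P? x ×-dec Q? x) xs ≡ filter Q? (filter P? xs)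
filter-×-dec P? Q? []       = refl
filter-×-dec P? Q? (x ∷ xs) with P? x
... | no  _ = filter-×-dec P? Q? xs
... | yes _ with Q? x
...   | yes _ = cong (x ∷_) (filter-×-dec P? Q? xs)
...   | no  _ = filter-×-dec P? Q? xs

product-map-filter : ∀ {Q : Pred ℕ 0ℓ} (Q? : Decidable Q) (f : ℕ → ℕ) xs →
  All (λ x → ¬ Q x → f x ≡ 1) xs → product (map f (filter Q? xs)) ≡ product (map f xs)
product-map-filter Q? f []       []               = refl
product-map-filter Q? f (x ∷ xs) (f≡1 ∷ fs≡1) with Q? x
... | yes _  = cong (f x *_) (product-map-filter Q? f xs fs≡1)
... | no  ¬q = trans (product-map-filter Q? f xs fs≡1)
                     (sym (trans (cong (_* product (map f xs)) (f≡1 ¬q)) (+-identityʳ _)))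

primesOf : ℕ → List ℕ
primesOf m = filter (λ q → prime? q ×-dec q ∣? m) (upTo (suc m))

primesOf-prime-∣ : ∀ m → All (λ q → Prime q × q ∣ m) (primesOf m)
primesOf-prime-∣ m = all-filter (λ q → prime? q ×-dec q ∣? m) (upTo (suc m))

primesOf-sorted : ∀ m → AllPairs _<_ (primesOf m)
primesOf-sorted m = AllPairs.filter⁺ (λ q → prime? q ×-dec q ∣? m) (upTo-sorted (suc m))

∈-primesOf : ∀ {m q} → 1 ≤ m → Prime q → q ∣ m → q ∈ primesOf m
∈-primesOf {m} 1≤m pq q∣m =
  ∈-filter⁺ (λ q → prime? q ×-dec q ∣? m) (∈-upTo⁺ (s≤s (∣⇒≤ {{>-nonZero 1≤m}} q∣m))) (pq , q∣m)

prime-power-product-primesOf : ∀ m → 1 ≤ m → product (map (λ q → q ^ val q m) (primesOf m)) ≡ m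
prime-power-product-primesOf m 1≤m = begin
  product (map f (primesOf m))                        ≡⟨ cong (product ∘ map f) (filter-×-dec prime? (_∣? m) (upTo (suc m))) ⟩
  product (map f (filter (_∣? m) (primesBelow (suc m)))) ≡⟨ product-map-filter (_∣? m) f (primesBelow (suc m)) (All.map ^val≡1 (all-filter prime? (upTo (suc m)))) ⟩
  product (map f (primesBelow (suc m)))                 ≡⟨ prime-power-product (suc m) m 1≤m ≤-refl ⟩
  m                                                     ∎
  where
  open ≡-Reasoning
  f : ℕ → ℕ
  f q = q ^ val q m
  ^val≡1 : ∀ {q} → Prime q → ¬ (q ∣ m) → f q ≡ 1
  ^val≡1 {q} pq q∤m = cong (q ^_) (val≡0 q m (prime⇒2≤ pq) 1≤m q∤m)

S-factorisation : ∀ r m → 1 ≤ m → ∃ λ X →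
  1 ≤ X × S r m ≡ X * product∸ r (primesOf m) × X * product (primesOf m) ≡ m
S-factorisation r m 1≤m = product (map f L) , 1≤X (primesOf-prime-∣ m) , product-map-* f (_∸ r) L , X*rad≡m
  where
  L = primesOf m
  f : ℕ → ℕ
  f q = q ^ (val q m ∸ 1)
  1≤X : ∀ {qs} → All (λ q → Prime q × q ∣ m) qs → 1 ≤ product (map f qs)
  1≤X []               = ≤-refl
  1≤X {q ∷ _} ((pq , _) ∷ rest) = *-mono-≤ (m^n>0 q {{prime⇒nonZero pq}} (val q m ∸ 1)) (1≤X rest)
  f*q≡ : ∀ {q} → Prime q × q ∣ m → f q * q ≡ q ^ val q m
  f*q≡ {q} (pq , q∣m) = trans (*-comm (f q) q)
    (cong (q ^_) (trans (+-comm 1 (val q m ∸ 1)) (m∸n+n≡m (1≤val q m (prime⇒2≤ pq) 1≤m q∣m))))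
  X*rad≡m : product (map f L) * product L ≡ m
  X*rad≡m = begin
    product (map f L) * product L             ≡⟨ cong (λ ys → product (map f L) * product ys) (sym (map-id L)) ⟩
    product (map f L) * product (map id L)    ≡⟨ sym (product-map-* f id L) ⟩
    product (map (λ q → f q * q) L)           ≡⟨ cong product (map-cong-local (All.map f*q≡ (primesOf-prime-∣ m))) ⟩
    product (map (λ q → q ^ val q m) L)       ≡⟨ prime-power-product-primesOf m 1≤m ⟩
    m                                         ∎
    where open ≡-Reasoning

S*product≤ : ∀ r m {ts} → 1 ≤ m → AllPairs _<_ ts → All (λ t → Prime t × t ∣ m) ts →
  S r m * product ts ≤ m * product∸ r ts
S*product≤ r m {ts} 1≤m ts-sorted ts-prime-∣ with S-factorisation r m 1≤m
... | X , _ , Sm≡ , X*rad≡m = begin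
  S r m * product ts                              ≡⟨ cong (_* product ts) Sm≡ ⟩
  X * product∸ r L * product ts                   ≡⟨ xy∙z≈x∙zy X (product∸ r L) (product ts) ⟩
  X * (product ts * product∸ r L)                 ≤⟨ *-monoʳ-≤ X (cross-mul (⊆⇒≽ r ts⊆L)) ⟩
  X * (product∸ r ts * product L)                 ≡⟨ x∙yz≈xz∙y X (product∸ r ts) (product L) ⟩
  X * product L * product∸ r ts                   ≡⟨ cong (_* product∸ r ts) X*rad≡m ⟩
  m * product∸ r ts                               ∎
  where
  open ≤-Reasoning
  L = primesOf m
  ts⊆L = sorted-⊆ ts-sorted (primesOf-sorted m) (All.map (λ (pt , t∣m) → ∈-primesOf 1≤m pt t∣m) ts-prime-∣)

segment : (ℕ → ℕ) → ℕ → ℕ → List ℕ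
segment g i zero    = []
segment g i (suc s) = g (suc i) ∷ segment g (suc i) s

segment-All : ∀ {P : ℕ → Set} g i s → (∀ j → P (g (suc j))) → All P (segment g i s)
segment-All g i zero    _  = []
segment-All g i (suc s) Pg = Pg i ∷ segment-All g (suc i) s Pg

segment-++ : ∀ g i t u → segment g i (t + u) ≡ segment g i t ++ segment g (t + i) u
segment-++ g i zero    u = refl
segment-++ g i (suc t) u = cong (g (suc i) ∷_)
  (trans (segment-++ g (suc i) t u) (cong (λ j → segment g (suc i) t ++ segment g j u) (+-suc t i)))

applyUpTo≡segment : ∀ g i s {f : ℕ → ℕ} → (∀ j → f j ≡ g (suc (i + j))) → applyUpTo f s ≡ segment g i s
applyUpTo≡segment g i zero    f≡ = refl
applyUpTo≡segment g i (suc s) f≡ = cong₂ _∷_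
  (trans (f≡ 0) (cong (g ∘ suc) (+-identityʳ i)))
  (applyUpTo≡segment g (suc i) s (λ j → trans (f≡ (suc j)) (cong (g ∘ suc) (+-suc i j))))

map-range≡segment : ∀ g i s → map g (range (suc i) (s + i)) ≡ segment g i s
map-range≡segment g i s = begin
  map g (map (suc i +_) (upTo (s + i ∸ i)))  ≡⟨ cong (map g ∘ map (suc i +_) ∘ upTo) (m+n∸n≡m s i) ⟩
  map g (map (suc i +_) (upTo s))            ≡⟨ sym (map-∘ (upTo s)) ⟩
  map (g ∘ (suc i +_)) (upTo s)              ≡⟨ map-upTo (g ∘ (suc i +_)) s ⟩
  applyUpTo (g ∘ (suc i +_)) s               ≡⟨ applyUpTo≡segment g i s (λ _ → refl) ⟩
  segment g i s                              ∎
  where open ≡-Reasoning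

segment-≤ᵖ-split : ∀ g b s L → Pointwise _≤_ (segment g b (length L)) L →
  length L ≤ s ⊎
  ∃₂ λ L₁ c → ∃ λ L₃ → L ≡ L₁ ++ c ∷ L₃ × Pointwise _≤_ (segment g b s) L₁ ×
    g (suc (s + b)) ≤ c × Pointwise _≤_ (segment g (suc (s + b)) (length L₃)) L₃
segment-≤ᵖ-split g b s       []       []          = inj₁ z≤n
segment-≤ᵖ-split g b zero    (c ∷ L₃) (gb≤c ∷ pw) = inj₂ ([] , c , L₃ , refl , [] , gb≤c , pw)
segment-≤ᵖ-split g b (suc s) (x ∷ L)  (gb≤x ∷ pw) with segment-≤ᵖ-split g (suc b) s L pw
... | inj₁ |L|≤s = inj₁ (s≤s |L|≤s)
... | inj₂ (L₁ , c , L₃ , refl , pw₁ , gₖ≤c , pw₃) rewrite +-suc s b =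
  inj₂ (x ∷ L₁ , c , L₃ , refl , gb≤x ∷ pw₁ , gₖ≤c , pw₃)

≤ᵖ-All-< : ∀ {r xs ys} → All (r <_) xs → Pointwise _≤_ xs ys → All (r <_) ys
≤ᵖ-All-< []           []           = []
≤ᵖ-All-< (r<x ∷ r<xs) (x≤y ∷ xs≤ys) = <-≤-trans r<x x≤y ∷ ≤ᵖ-All-< r<xs xs≤ys

module _ {g : ℕ → ℕ} (g-inc : ∀ i → g i < g (suc i)) where

  g-mono : ∀ {i j} → i ≤ j → g i ≤ g j
  g-mono {i} i≤j with k , refl ← m≤n⇒∃[o]m+o≡n i≤j = go k
    where
    go : ∀ k → g i ≤ g (i + k)
    go zero    = ≤-reflexive (cong g (sym (+-identityʳ i)))
    go (suc k) = ≤-trans (go k) (≤-trans (<⇒≤ (g-inc (i + k))) (≤-reflexive (cong g (sym (+-suc i k)))))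

  segment-> : ∀ {r} i s → r < g (suc i) → All (r <_) (segment g i s)
  segment-> i zero    _   = []
  segment-> i (suc s) r<g = r<g ∷ segment-> (suc i) s (<-trans r<g (g-inc (suc i)))

  segment-≤ : ∀ {c} i s → g (s + i) ≤ c → All (_≤ c) (segment g i s)
  segment-≤ i zero    _      = []
  segment-≤ {c} i (suc s) g≤c = ≤-trans (g-mono (s≤s (m≤n+m i s))) g≤c
    ∷ segment-≤ (suc i) s (subst (λ j → g j ≤ c) (sym (+-suc s i)) g≤c)

  segment-sorted : ∀ i s → AllPairs _<_ (segment g i s)
  segment-sorted i zero    = []
  segment-sorted i (suc s) = segment-> (suc i) s (g-inc (suc i)) ∷ segment-sorted (suc i) s

∈-range⁺ : ∀ {a c x} → a ≤ x → x ≤ c → x ∈ range a c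
∈-range⁺ {a} {c} a≤x x≤c = subst (_∈ range a c) (m+[n∸m]≡n a≤x)
  (∈-map⁺ (a +_) (∈-upTo⁺ (∸-monoˡ-< (s≤s x≤c) a≤x)))

<∸⇒+< : ∀ a j n → j < n ∸ a → a + j < n
<∸⇒+< zero    j n       j<n = j<n
<∸⇒+< (suc a) j (suc n) j<n = s≤s (<∸⇒+< a j n j<n)

∈-range⁻ : ∀ {a c x} → x ∈ range a c → a ≤ x × x ≤ c
∈-range⁻ {a} {c} x∈ with j , j∈ , refl ← ∈-map⁻ (a +_) x∈ =
  m≤m+n a j , ≤-pred (<∸⇒+< a j (suc c) (∈-upTo⁻ j∈))

range-sorted : ∀ a c → AllPairs _<_ (range a c)
range-sorted a c = AllPairs.map⁺ (AllPairs.map (+-monoʳ-< a) (upTo-sorted (suc c ∸ a)))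

firstOr0-∈ : ∀ {y ys} → y ∈ ys → firstOr0 ys ∈ ys
firstOr0-∈ (here _)  = here refl
firstOr0-∈ (there _) = here refl

firstOr0-≤ : ∀ {y ys} → AllPairs _<_ ys → y ∈ ys → firstOr0 ys ≤ y
firstOr0-≤ _         (here refl) = ≤-refl
firstOr0-≤ (x<ys ∷ _) (there y∈) = <⇒≤ (All.lookup x<ys y∈)

∣! : ∀ {z p} → 1 ≤ z → z ≤ p → z ∣ p !
∣! {suc z} _ z≤p = ∣-trans (m∣m*n (z !)) (m≤n⇒m!∣n! z≤p)

-- Euclid: every prime factor of p ! + 1 exceeds p.
∃prime∈⟨p,p+p!] : ∀ p → 1 ≤ p → ∃ λ z → Prime z × p < z × z ≤ p + p !
∃prime∈⟨p,p+p!] p 1≤p with z , pz , z∣p!+1 ← prime-factor (p ! + 1) (+-monoˡ-≤ 1 (1≤n! p)) =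
  z , pz , p<z , z≤p+p!
  where
  p<z : p < z
  p<z = ≰⇒> λ z≤p → <-irrefl (sym (∣1⇒≡1 (∣m+n∣m⇒∣n z∣p!+1 (∣! (<-trans (s≤s z≤n) (prime⇒2≤ pz)) z≤p))))
                              (prime⇒2≤ pz)
  z≤p+p! : z ≤ p + p !
  z≤p+p! = ≤-trans (∣⇒≤ (subst (z ∣_) (+-comm (p !) 1) z∣p!+1)) (+-monoˡ-≤ (p !) 1≤p)

module NextPrime (p : ℕ) (1≤p : 1 ≤ p) where

  private
    candidates = filter prime? (range (suc p) (p + p !))

    candidates-sorted : AllPairs _<_ candidates
    candidates-sorted = AllPairs.filter⁺ prime? (range-sorted (suc p) (p + p !))

    nextPrime∈ : nextPrime p ∈ candidates
    nextPrime∈ with z , pz , p<z , z≤ ← ∃prime∈⟨p,p+p!] p 1≤p =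
      firstOr0-∈ (∈-filter⁺ prime? (∈-range⁺ p<z z≤) pz)

    nextPrime∈range = proj₁ (∈-filter⁻ prime? {xs = range (suc p) (p + p !)} nextPrime∈)

  nextPrime-prime : Prime (nextPrime p)
  nextPrime-prime = proj₂ (∈-filter⁻ prime? {xs = range (suc p) (p + p !)} nextPrime∈)

  p<nextPrime : p < nextPrime p
  p<nextPrime = proj₁ (∈-range⁻ nextPrime∈range)

  nextPrime-least : ∀ q → Prime q → p < q → nextPrime p ≤ q
  nextPrime-least q pq p<q with q ≤? p + p !
  ... | yes q≤ = firstOr0-≤ candidates-sorted (∈-filter⁺ prime? (∈-range⁺ p<q q≤) pq)
  ... | no  q≰ = ≤-trans (proj₂ (∈-range⁻ nextPrime∈range)) (<⇒≤ (≰⇒> q≰))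

nthPrime-prime : ∀ i → Prime (nthPrime (suc i))
nthPrime-prime zero    = prime[2]
nthPrime-prime (suc i) = NextPrime.nextPrime-prime (nthPrime (suc i)) (<-trans (s≤s z≤n) (prime⇒2≤ (nthPrime-prime i)))

nthPrime-< : ∀ i → nthPrime i < nthPrime (suc i)
nthPrime-< zero    = s≤s (s≤s z≤n)
nthPrime-< (suc i) = NextPrime.p<nextPrime (nthPrime (suc i)) (<-trans (s≤s z≤n) (prime⇒2≤ (nthPrime-prime i)))

nthPrime-least : ∀ i q → Prime q → nthPrime i < q → nthPrime (suc i) ≤ q
nthPrime-least zero    q pq _ = prime⇒2≤ pq
nthPrime-least (suc i) q pq h = NextPrime.nextPrime-least (nthPrime (suc i)) (<-trans (s≤s z≤n) (prime⇒2≤ (nthPrime-prime i))) q pq h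

i<nthPrime : ∀ i → i < nthPrime i
i<nthPrime zero    = s≤s z≤n
i<nthPrime (suc i) = <-≤-trans (s≤s (i<nthPrime i)) (nthPrime-< i)

nthPrime-b≤ : ∀ r → 1 ≤ r → nthPrime (b r) ≤ r
nthPrime-b≤ r 1≤r with maxList-∈ (filter (λ i → nthPrime i ≤? r) (range 1 r))
... | inj₁ b≡0 = subst (λ i → nthPrime i ≤ r) (sym b≡0) 1≤r
... | inj₂ b∈  = proj₂ (∈-filter⁻ (λ i → nthPrime i ≤? r) {xs = range 1 r} b∈)

<nthPrime-suc-b : ∀ r → r < nthPrime (suc (b r))
<nthPrime-suc-b r with nthPrime (suc (b r)) ≤? r
... | no  p≰r = ≰⇒> p≰r
... | yes p≤r = ⊥-elim (<-irrefl refl (maxList-upper (∈-filter⁺ (λ i → nthPrime i ≤? r)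
                  (∈-range⁺ (s≤s z≤n) (<⇒≤ (<-≤-trans (i<nthPrime (suc (b r))) p≤r))) p≤r)))

segment≤ᵖprimes : ∀ i L → AllPairs _<_ L → All Prime L → All (nthPrime i <_) L →
  Pointwise _≤_ (segment nthPrime i (length L)) L
segment≤ᵖprimes i []       _             _         _            = []
segment≤ᵖprimes i (x ∷ L) (x<L ∷ sorted) (px ∷ pL) (pᵢ<x ∷ _) =
  nthPrime-least i x px pᵢ<x ∷
  segment≤ᵖprimes (suc i) L sorted pL (All.map (≤-<-trans (nthPrime-least i x px pᵢ<x)) x<L)

-- The argument for an arbitrary increasing sequence g; for g = nthPrime and k = suc (s + b),
-- G lists p_{b+1}, …, p_{k−1} and T the prime factors of n.
module SparseBound (g : ℕ → ℕ) (g-inc : ∀ i → g i < g (suc i)) (r b s d q : ℕ)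
  (r<g : r < g (suc b))
  (gₖ≤q : g (suc (s + b)) ≤ q)
  (d<gₖ₊₁∸r : d < g (suc (suc (s + b))) ∸ r)
  (dq<gₖ : d * (q ∸ r) < suc d * (g (suc (s + b)) ∸ r))
  where

  gₖ : ℕ
  gₖ = g (suc (s + b))

  G T : List ℕ
  G = segment g b s
  T = G ++ q ∷ []

  r<G : All (r <_) G
  r<G = segment-> g-inc b s r<g

  r<gₖ : r < gₖ
  r<gₖ = <-≤-trans r<g (g-mono g-inc (s≤s (m≤n+m b s)))

  r<q : r < q
  r<q = <-≤-trans r<gₖ gₖ≤q

  r<T : All (r <_) T
  r<T = All.++⁺ r<G (r<q ∷ [])

  T-sorted : AllPairs _<_ T
  T-sorted = AllPairs.++⁺ (segment-sorted g-inc b s) ([] ∷ [])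
    (All.map (λ x≤ → ≤-<-trans x≤ (<-≤-trans (g-inc (s + b)) gₖ≤q) ∷ []) (segment-≤ g-inc b s ≤-refl))

  private
    E : ℕ
    E = product∸ r G

    G≤ : ∀ {c} → gₖ ≤ c → All (_≤ c) G
    G≤ gₖ≤c = segment-≤ g-inc b s (<⇒≤ (<-≤-trans (g-inc (s + b)) gₖ≤c))

    d*R[T]< : d * product∸ r T < suc d * (E * (gₖ ∸ r))
    d*R[T]< = begin-strict
      d * product∸ r T        ≡⟨ cong (d *_) (product∸-snoc r G q) ⟩
      d * (E * (q ∸ r))       ≡⟨ x∙yz≈y∙xz d E (q ∸ r) ⟩
      E * (d * (q ∸ r))       <⟨ *-monoʳ-< E {{>-nonZero (product∸>0 r<G)}} dq<gₖ ⟩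
      E * (suc d * (gₖ ∸ r))  ≡⟨ x∙yz≈y∙xz E (suc d) (gₖ ∸ r) ⟩
      suc d * (E * (gₖ ∸ r))  ∎
      where open ≤-Reasoning

  few-primes : ∀ L → Pointwise _≤_ (segment g b (length L)) L → length L ≤ s → T ≼[ r ] L
  few-primes L pw |L|≤s = subst (_≼[ r ] L) T≡ (≼-++ʳ (segment g (t + b) (s ∸ t) ++ q ∷ []) (≼-monoᵖ r pw))
    where
    t = length L
    T≡ : segment g b t ++ segment g (t + b) (s ∸ t) ++ q ∷ [] ≡ T
    T≡ = trans (sym (++-assoc (segment g b t) _ _))
      (cong (_++ q ∷ []) (trans (sym (segment-++ g b t (s ∸ t))) (cong (segment g b) (m+[n∸m]≡n |L|≤s))))

  many-primes : ∀ X L₁ c c₂ L₄ → 1 ≤ X → Pointwise _≤_ G L₁ → gₖ ≤ c → g (suc (suc (s + b))) ≤ c₂ →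
    All (r <_) L₄ → d * product∸ r T < X * product∸ r (L₁ ++ c ∷ c₂ ∷ L₄)
  many-primes X L₁ c c₂ L₄ 1≤X G≤L₁ gₖ≤c gₖ₊₁≤c₂ r<L₄ = begin-strict
    d * product∸ r T                                          <⟨ d*R[T]< ⟩
    suc d * (E * (gₖ ∸ r))                                    ≤⟨ *-monoˡ-≤ (E * (gₖ ∸ r)) d<c₂∸r*R₄ ⟩
    ((c₂ ∸ r) * R₄) * (E * (gₖ ∸ r))                          ≡⟨ x∙yz≈y∙zx ((c₂ ∸ r) * R₄) E (gₖ ∸ r) ⟩
    E * ((gₖ ∸ r) * ((c₂ ∸ r) * R₄))                          ≤⟨ *-mono-≤ (product∸-monoᵖ r G≤L₁) (*-monoˡ-≤ _ (∸-monoˡ-≤ r gₖ≤c)) ⟩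
    product∸ r L₁ * product∸ r (c ∷ c₂ ∷ L₄)                  ≡⟨ sym (product∸-++ r L₁ (c ∷ c₂ ∷ L₄)) ⟩
    product∸ r (L₁ ++ c ∷ c₂ ∷ L₄)                            ≤⟨ m≤n*m _ X {{>-nonZero 1≤X}} ⟩
    X * product∸ r (L₁ ++ c ∷ c₂ ∷ L₄)                        ∎
    where
    open ≤-Reasoning
    R₄ = product∸ r L₄
    d<c₂∸r*R₄ : suc d ≤ (c₂ ∸ r) * R₄
    d<c₂∸r*R₄ = ≤-trans d<gₖ₊₁∸r (≤-trans (∸-monoˡ-≤ r gₖ₊₁≤c₂) (m≤m*n (c₂ ∸ r) R₄ {{>-nonZero (product∸>0 r<L₄)}}))

  large-cofactor : ∀ X L₁ c → suc d ≤ X → Pointwise _≤_ G L₁ → gₖ ≤ c →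
    d * product∸ r T < X * product∸ r (L₁ ++ c ∷ [])
  large-cofactor X L₁ c d<X G≤L₁ gₖ≤c = begin-strict
    d * product∸ r T                 <⟨ d*R[T]< ⟩
    suc d * (E * (gₖ ∸ r))           ≤⟨ *-mono-≤ d<X (*-mono-≤ (product∸-monoᵖ r G≤L₁) (∸-monoˡ-≤ r gₖ≤c)) ⟩
    X * (product∸ r L₁ * (c ∸ r))    ≡⟨ cong (X *_) (sym (product∸-snoc r L₁ c)) ⟩
    X * product∸ r (L₁ ++ c ∷ [])    ∎
    where open ≤-Reasoning

  small-last-prime : ∀ X L₁ c → X ≤ d → Pointwise _≤_ G L₁ → gₖ ≤ c →
    d * product T < X * product (L₁ ++ c ∷ []) → T ≼[ r ] (L₁ ++ c ∷ [])
  small-last-prime X L₁ c X≤d G≤L₁ gₖ≤c n<m = ≼-snoc G≤L₁ r<G (G≤ gₖ≤c) (<⇒≤ r<q) (<⇒≤ Gq<L₁c)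
    where
    Gq<L₁c : product G * q < product L₁ * c
    Gq<L₁c = *-cancelˡ-< X _ _ (begin-strict
      X * (product G * q)       ≤⟨ *-monoˡ-≤ _ X≤d ⟩
      d * (product G * q)       ≡⟨ cong (d *_) (sym (product-snoc G q)) ⟩
      d * product T             <⟨ n<m ⟩
      X * product (L₁ ++ c ∷ []) ≡⟨ cong (X *_) (product-snoc L₁ c) ⟩
      X * (product L₁ * c)      ∎)
      where open ≤-Reasoning

  sparse-bound : ∀ X L → 1 ≤ X → Pointwise _≤_ (segment g b (length L)) L →
                 d * product T < X * product L → d * product∸ r T < X * product∸ r L
  sparse-bound X L 1≤X pw n<m with segment-≤ᵖ-split g b s L pw
  ... | inj₁ |L|≤s = ≼-transfer d X (few-primes L pw |L|≤s) r<T n<m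
  ... | inj₂ (L₁ , c , c₂ ∷ L₄ , refl , G≤L₁ , gₖ≤c , gₖ₊₁≤c₂ ∷ pw₄) =
    many-primes X L₁ c c₂ L₄ 1≤X G≤L₁ gₖ≤c gₖ₊₁≤c₂
      (≤ᵖ-All-< (segment-> g-inc _ _ (<-trans r<gₖ (<-trans (g-inc _) (g-inc _)))) pw₄)
  ... | inj₂ (L₁ , c , [] , refl , G≤L₁ , gₖ≤c , []) with suc d ≤? X | q ≤? c
  ...   | yes d<X | _       = large-cofactor X L₁ c d<X G≤L₁ gₖ≤c
  ...   | no  d≮X | yes q≤c = ≼-transfer d X (≼-monoᵖ r (Pointwise.++⁺ G≤L₁ (q≤c ∷ []))) r<T n<m
  ...   | no  d≮X | no  _   = ≼-transfer d X (small-last-prime X L₁ c (≤-pred (≰⇒> d≮X)) G≤L₁ gₖ≤c n<m) r<T n<m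

B-1 : ∀ r → B r 1
B-1 r = ≤-refl , λ p pp p∣1 → ⊥-elim (<-irrefl (sym (∣1⇒≡1 p∣1)) (prime⇒2≤ pp))

B-* : ∀ {r m n} → B r m → B r n → B r (m * n)
B-* {m = m} {n} (1≤m , m-rough) (1≤n , n-rough) =
  *-mono-≤ 1≤m 1≤n , λ p pp p∣mn → [ m-rough p pp , n-rough p pp ]′ (euclidsLemma m n pp p∣mn)

B-prime : ∀ {r p} → Prime p → r < p → B r p
B-prime {r} {p} pp r<p = <-trans (s≤s z≤n) (prime⇒2≤ pp) , rough
  where
  rough : ∀ p′ → Prime p′ → p′ ∣ p → r < p′
  rough p′ pp′ p′∣p with prime⇒irreducible pp p′∣p
  ... | inj₁ refl = ⊥-elim (<-irrefl refl (prime⇒2≤ pp′))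
  ... | inj₂ refl = r<p

B-product : ∀ {r ps} → All Prime ps → All (r <_) ps → B r (product ps)
B-product {r} []          []          = B-1 r
B-product     (pp ∷ pps) (r<p ∷ r<ps) = B-* (B-prime pp r<p) (B-product pps r<ps)

∣product : ∀ xs → All (_∣ product xs) xs
∣product []       = []
∣product (x ∷ xs) = m∣m*n (product xs) ∷ All.map (∣n⇒∣m*n x) (∣product xs)

module _ (r ℓ s d : ℕ) (1≤r : 1 ≤ r) (Bd : B r d) where

  private
    k = suc (s + b r)
    q = nthPrime (k + ℓ)

  d*product∈F : d < nthPrime (suc k) ∸ r → d * (q ∸ r) < suc d * (nthPrime k ∸ r) →
           F r (d * product (segment nthPrime (b r) s ++ q ∷ []))
  d*product∈F d<pₖ₊₁∸r dq<pₖ = B-n , S-n<S-m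
    where
    open SparseBound nthPrime nthPrime-< r (b r) s d q (<nthPrime-suc-b r) (g-mono nthPrime-< (m≤m+n k ℓ))
      d<pₖ₊₁∸r dq<pₖ
    T-prime : All Prime T
    T-prime = All.++⁺ (segment-All nthPrime (b r) s nthPrime-prime) (nthPrime-prime (s + b r + ℓ) ∷ [])
    B-n : B r (d * product T)
    B-n = B-* Bd (B-product T-prime r<T)
    S-n≤ : S r (d * product T) ≤ d * product∸ r T
    S-n≤ = *-cancelʳ-≤ _ _ (product T) {{>-nonZero (product>0 r<T)}} (begin
      S r (d * product T) * product T   ≤⟨ S*product≤ r (d * product T) (proj₁ B-n) T-sorted T-prime-∣ ⟩
      d * product T * product∸ r T      ≡⟨ xy∙z≈xz∙y d (product T) (product∸ r T) ⟩
      d * product∸ r T * product T      ∎)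
      where
      open ≤-Reasoning
      T-prime-∣ = All.zipWith (λ (pt , t∣T) → pt , ∣n⇒∣m*n d t∣T) (T-prime , ∣product T)
    S-n<S-m : ∀ m → B r m → d * product T < m → S r (d * product T) < S r m
    S-n<S-m m (1≤m , m-rough) n<m with X , 1≤X , Sm≡ , X*rad≡m ← S-factorisation r m 1≤m =
      ≤-<-trans S-n≤ (subst (d * product∸ r T <_) (sym Sm≡)
        (sparse-bound X L 1≤X L-lower (subst (d * product T <_) (sym X*rad≡m) n<m)))
      where
      L = primesOf m
      L-lower : Pointwise _≤_ (segment nthPrime (b r) (length L)) L
      L-lower = segment≤ᵖprimes (b r) L (primesOf-sorted m) (All.map proj₁ (primesOf-prime-∣ m))
        (All.map (λ (pp , p∣m) → ≤-<-trans (nthPrime-b≤ r 1≤r) (m-rough _ pp p∣m)) (primesOf-prime-∣ m))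

primeProd≡product-segment : ∀ i s → primeProd (i + 1) (s + i) ≡ product (segment nthPrime i s)
primeProd≡product-segment i s = begin
  primeProd (i + 1) (s + i)                         ≡⟨ cong (λ j → primeProd j (s + i)) (+-comm i 1) ⟩
  product (map nthPrime (range (suc i) (s + i)))    ≡⟨ cong product (map-range≡segment nthPrime i s) ⟩
  product (segment nthPrime i s)                    ∎
  where open ≡-Reasoning

<⇒∃[s]suc[s+m]≡n : ∀ {m n} → m < n → ∃ λ s → suc (s + m) ≡ n
<⇒∃[s]suc[s+m]≡n {m} {n} m<n = n ∸ suc m , trans (sym (+-suc (n ∸ suc m) m)) (m∸n+n≡m m<n)

theorem2p1 : (r ℓ k d : ℕ) → 1 ≤ r → b r + 2 ≤ k → B r d →
    d < nthPrime (k + 1) ∸ r →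
    d * (nthPrime (k + ℓ) ∸ r) < (d + 1) * (nthPrime k ∸ r) →
    F r (d * nthPrime (k + ℓ) * primeProd (b r + 1) (k ∸ 1))
theorem2p1 r ℓ k d 1≤r b+2≤k Bd d<pₖ₊₁∸r dpₖ₊ℓ<
  with s , refl ← <⇒∃[s]suc[s+m]≡n (<-≤-trans (m<m+n (b r) (s≤s z≤n)) b+2≤k) =
  subst (F r) n≡ (d*product∈F r ℓ s d 1≤r Bd
    (subst (λ j → d < nthPrime j ∸ r) (+-comm k 1) d<pₖ₊₁∸r)
    (subst (λ e → d * (q ∸ r) < e * (nthPrime k ∸ r)) (+-comm d 1) dpₖ₊ℓ<))
  where
  q = nthPrime (k + ℓ)
  G = segment nthPrime (b r) s
  n≡ : d * product (G ++ q ∷ []) ≡ d * q * primeProd (b r + 1) (s + b r)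
  n≡ = begin
    d * product (G ++ q ∷ [])               ≡⟨ cong (d *_) (product-snoc G q) ⟩
    d * (product G * q)                     ≡⟨ x∙yz≈xz∙y d (product G) q ⟩
    d * q * product G                       ≡⟨ cong (d * q *_) (sym (primeProd≡product-segment (b r) s)) ⟩
    d * q * primeProd (b r + 1) (s + b r)   ∎
    where open ≡-Reasoning
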